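{- Let $C_n$ be a signed cycle with vertices $v_1,\dots,v_n$ in cyclic order, and let $T_{m_1},T_{m_2}$ be vertex-disjoint signed trees with $m_1,m_2$ vertices. Let $U=U(C_n,T_{m_1},T_{m_2},l)$ be the signed unicyclic graph obtained by joining the root of $T_{m_1}$ by an edge to $v_1$ and the root of $T_{m_2}$ by an edge to $v_{l+1}$, where $v_1$ and $v_{l+1}$ are at distance $l\ge1$ on the cycle. Then $$\det U=\det\big(U(C_n,T_{m_2})\big)\det(T_{m_1})+\det(\{T_{m_1},v_1\})\det(\{T_{m_2},v_{l+1}\})\det(P_{l-1})\det(P_{n-l-1})+\det(\{T_{m_1},v_1\})\det(T_{m_2})\det(P_{n-1}).$$
   Context: A signed graph has edge weights in $\{1,-1\}$ and its determinant is that of its adjacency matrix; the determinant of the empty graph is $1$. $U(C_n,T_{m_2})$ is the subgraph of $U$ obtained by deleting $T_{m_1}$. $\{T,w\}$ denotes the subgraph induced by the vertices of tree $T$ together with vertex $w$. $P_{n-1}$ is the signed path $C_n\setminus v_1$; $P_{l-1}$ and $P_{n-l-1}$ are the two signed paths forming $C_n\setminus\{v_1,v_{l+1}\}$ (on $l-1$ and $n-l-1$ vertices). -}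

module Defs where

open import Data.Nat as ℕ using (ℕ; zero; suc; _≡ᵇ_; _<ᵇ_; _∸_)
open import Data.Integer as ℤ using (ℤ; +_; -[1+_]; _+_; _*_; -_)
open import Data.Fin as Fin using (Fin; zero; suc; toℕ; punchIn; splitAt; _↑ˡ_; _↑ʳ_)
open import Data.List using (List; []; _∷_; length; lookup; allFin; map; _++_; take; drop)
open import Data.Bool using (Bool; true; false; if_then_else_; _∧_; _∨_)
open import Data.Sum using (_⊎_; inj₁; inj₂)
import Data.Sum as Sum
open import Data.Product using (_×_)
open import Relation.Nullary using (does)
open import Relation.Binary.PropositionalEquality using (_≡_)
open import Function using (_∘_)

Mat : ℕ → Set
Mat n = Fin n → Fin n → ℤ

∑ : ∀ {n} → (Fin n → ℤ) → ℤ
∑ {zero}  f = + 0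
∑ {suc n} f = f zero + ∑ (f ∘ suc)

∑ℕ : ∀ {n} → (Fin n → ℕ) → ℕ
∑ℕ {zero}  f = 0
∑ℕ {suc n} f = f zero ℕ.+ ∑ℕ (f ∘ suc)

alt : ℕ → ℤ
alt zero    = + 1
alt (suc k) = - alt k

det : ∀ {n} → Mat n → ℤ
det {zero}  A = + 1
det {suc n} A = ∑ λ j → alt (toℕ j) * A zero j * det (λ r c → A (suc r) (punchIn j c))

induced : ∀ {N} → Mat N → (xs : List (Fin N)) → Mat (length xs)
induced A xs i j = A (lookup xs i) (lookup xs j)

IsSign : ℤ → Set
IsSign s = (s ≡ + 1) ⊎ (s ≡ -[1+ 0 ])

IsSignedGraph : ∀ {m} → Mat m → Set
IsSignedGraph A = (∀ i j → A i j ≡ A j i) × (∀ i → A i i ≡ + 0)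
                × (∀ i j → (A i j ≡ + 0) ⊎ IsSign (A i j))

nz : ℤ → ℕ
nz (+ zero)  = 0
nz (+ suc _) = 1
nz -[1+ _ ]  = 1

edgeCount : ∀ {m} → Mat m → ℕ
edgeCount A = ∑ℕ λ i → ∑ℕ λ j → if toℕ i <ᵇ toℕ j then nz (A i j) else 0

data Reach {m} (A : Mat m) (i : Fin m) : Fin m → Set where
  here : Reach A i i
  step : ∀ {j k} → Reach A i j → nz (A j k) ≡ 1 → Reach A i k

Connected : ∀ {m} → Mat m → Set
Connected A = ∀ i j → Reach A i j

IsSignedTree : ∀ {m} → Mat m → Set
IsSignedTree {m} A = IsSignedGraph A × Connected A × (edgeCount A ≡ m ∸ 1)

-- Signed cycle on Fin n (n ≥ 3): v_i ~ v_{i+1} (indices mod n), edge v_i v_{i+1} has sign σ i.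
nextB : ∀ {n} → Fin n → Fin n → Bool
nextB {n} i j = (suc (toℕ i) ≡ᵇ toℕ j) ∨ ((suc (toℕ i) ≡ᵇ n) ∧ (toℕ j ≡ᵇ 0))

cycAdj : ∀ {n} → (Fin n → ℤ) → Mat n
cycAdj σ i j = if nextB i j then σ i else (if nextB j i then σ j else + 0)

joinE : ∀ {n m} → Fin n → Fin m → ℤ → Fin n → Fin m → ℤ
joinE v r s i a = if does (i Fin.≟ v) ∧ does (a Fin.≟ r) then s else + 0

-- Vertex set of U: Fin (n + (m₁ + m₂)) = cycle ⊎ (T₁ ⊎ T₂)
classify : ∀ {n m₁ m₂} → Fin (n ℕ.+ (m₁ ℕ.+ m₂)) → Fin n ⊎ (Fin m₁ ⊎ Fin m₂)
classify {n} {m₁} x = Sum.map₂ (splitAt m₁) (splitAt n x)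

cyc : ∀ {n} m₁ m₂ → Fin n → Fin (n ℕ.+ (m₁ ℕ.+ m₂))
cyc m₁ m₂ i = i ↑ˡ (m₁ ℕ.+ m₂)

t₁ : ∀ n {m₁} m₂ → Fin m₁ → Fin (n ℕ.+ (m₁ ℕ.+ m₂))
t₁ n m₂ a = n ↑ʳ (a ↑ˡ m₂)

t₂ : ∀ n m₁ {m₂} → Fin m₂ → Fin (n ℕ.+ (m₁ ℕ.+ m₂))
t₂ n m₁ a = n ↑ʳ (m₁ ↑ʳ a)

-- U(C_n, T_{m₁}, T_{m₂}, l): root r₁ of T₁ joined to v₁ by an edge of sign s₁,
-- root r₂ of T₂ joined to w = v_{l+1} by an edge of sign s₂.
module _ {n m₁ m₂ : ℕ} (σ : Fin n → ℤ) (T₁ : Mat m₁) (T₂ : Mat m₂)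
         (r₁ : Fin m₁) (r₂ : Fin m₂) (v₁ w : Fin n) (s₁ s₂ : ℤ) where
  adj⊎ : Fin n ⊎ (Fin m₁ ⊎ Fin m₂) → Fin n ⊎ (Fin m₁ ⊎ Fin m₂) → ℤ
  adj⊎ (inj₁ i)        (inj₁ j)        = cycAdj σ i j
  adj⊎ (inj₁ i)        (inj₂ (inj₁ a)) = joinE v₁ r₁ s₁ i a
  adj⊎ (inj₁ i)        (inj₂ (inj₂ a)) = joinE w r₂ s₂ i a
  adj⊎ (inj₂ (inj₁ a)) (inj₁ i)        = joinE v₁ r₁ s₁ i a
  adj⊎ (inj₂ (inj₂ a)) (inj₁ i)        = joinE w r₂ s₂ i a
  adj⊎ (inj₂ (inj₁ a)) (inj₂ (inj₁ b)) = T₁ a b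
  adj⊎ (inj₂ (inj₂ a)) (inj₂ (inj₂ b)) = T₂ a b
  adj⊎ (inj₂ (inj₁ a)) (inj₂ (inj₂ b)) = + 0
  adj⊎ (inj₂ (inj₂ a)) (inj₂ (inj₁ b)) = + 0

  unicyclic : Mat (n ℕ.+ (m₁ ℕ.+ m₂))
  unicyclic x y = adj⊎ (classify x) (classify y)

-- A bridge pq of a graph G splits it into parts X ∋ p and Y ∋ q, and expanding det G along
-- the row of p gives  det G = det X · det Y − a_pq a_qp · det (X − p) · det (Y − q).
-- Apply this to the edge from v₁ to the root of T₁, then (in C_n − v₁ plus T₂) to the edge from
-- v_{l+1} to the root of T₂; removing v₁ and v_{l+1} leaves P_{l-1} and P_{n-l-1} with no edge
-- between them, so that determinant factors.  With X = {v}, the same formula gives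
-- det {T, v} = − a_vr a_rv det (T − r) because v carries no loop, and a ring identity finishes.

module Submission where

module ListDeterminant where

  open import Data.Nat as ℕ using (ℕ; zero; suc)
  import Data.Nat.Properties as ℕₚ
  open import Data.Fin using (Fin; zero; suc; toℕ; punchIn)
  open import Data.Integer using (ℤ; +_; _+_; _*_; -_; _-_; -1ℤ)
  import Data.Integer.Properties as ℤₚ
  open import Data.Integer.Tactic.RingSolver using (solve-∀)
  open import Data.List using (List; []; _∷_; [_]; length; _++_; tabulate; lookup)
  open import Data.List.Properties using (length-++; ++-assoc; tabulate-lookup)
  open import Data.List.Membership.Propositional using (_∈_)
  open import Data.List.Relation.Unary.Any using (here; there)
  open import Data.List.Relation.Binary.Permutation.Propositional
    using (_↭_; refl; prep; swap; trans)
  open import Data.List.Relation.Binary.Permutation.Propositional.Properties using (↭-length)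
  open import Data.Product using (Σ-syntax; _×_; _,_)
  open import Function using (_∘_; flip)
  open import Relation.Binary.PropositionalEquality
    using (_≡_; refl; sym; cong; cong₂; module ≡-Reasoning)
    renaming (trans to ≡-trans)
  open import Defs using (alt; ∑; det; Mat; induced)

  open ≡-Reasoning

  ∑-cong : ∀ {n} {f g : Fin n → ℤ} → (∀ i → f i ≡ g i) → ∑ f ≡ ∑ g
  ∑-cong {zero}  h = refl
  ∑-cong {suc n} h = cong₂ _+_ (h zero) (∑-cong (h ∘ suc))

  ∑-neg : ∀ {n} (f : Fin n → ℤ) → ∑ (λ i → - f i) ≡ - ∑ f
  ∑-neg {zero}  f = refl
  ∑-neg {suc n} f = ≡-trans (cong (λ z → - f zero + z) (∑-neg (f ∘ suc)))
                            (sym (ℤₚ.neg-distrib-+ (f zero) _))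

  det-cong : ∀ {n} {A B : Mat n} → (∀ i j → A i j ≡ B i j) → det A ≡ det B
  det-cong {zero}  h = refl
  det-cong {suc n} h = ∑-cong (λ j → cong₂ _*_ (cong (alt (toℕ j) *_) (h zero j))
                                              (det-cong (λ r c → h (suc r) (punchIn j c))))

  alt-square : ∀ k → alt k * alt k ≡ + 1
  alt-square zero    = refl
  alt-square (suc k) = ≡-trans (square-neg (alt k)) (alt-square k)
    where square-neg : ∀ a → (- a) * (- a) ≡ a * a
          square-neg = solve-∀

  module _ {V : Set} where

    -- laplace f (c₀ ∷ … ∷ cₖ) = ∑ᵢ (-1)ⁱ f cᵢ (the list without cᵢ)
    laplace : (V → List V → ℤ) → List V → ℤ
    laplace f []       = + 0
    laplace f (c ∷ cs) = f c cs - laplace (λ d ds → f d (c ∷ ds)) cs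

    -- the determinant of the submatrix with rows rs and columns cs, in these orders
    minor : (V → V → ℤ) → List V → List V → ℤ
    minor M []       cs = + 1
    minor M (r ∷ rs) cs = laplace (λ d ds → M r d * minor M rs ds) cs

    detOn : (V → V → ℤ) → List V → ℤ
    detOn M xs = minor M xs xs

    laplace-cong-∈ : ∀ {f g} cs →
      (∀ d ds → d ∈ cs → suc (length ds) ≡ length cs → f d ds ≡ g d ds) →
      laplace f cs ≡ laplace g cs
    laplace-cong-∈ []       h = refl
    laplace-cong-∈ (c ∷ cs) h = cong₂ _-_ (h c cs (here refl) refl)
      (laplace-cong-∈ cs (λ d ds d∈cs eq → h d (c ∷ ds) (there d∈cs) (cong suc eq)))

    laplace-cong : ∀ {f g} cs → (∀ d ds → f d ds ≡ g d ds) → laplace f cs ≡ laplace g cs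
    laplace-cong cs h = laplace-cong-∈ cs (λ d ds _ _ → h d ds)

    laplace-zero : ∀ {f} cs → (∀ d ds → d ∈ cs → f d ds ≡ + 0) → laplace f cs ≡ + 0
    laplace-zero []       h = refl
    laplace-zero (c ∷ cs) h
      rewrite h c cs (here refl) | laplace-zero cs (λ d ds d∈cs → h d (c ∷ ds) (there d∈cs)) = refl

    laplace-++ : ∀ f as bs → laplace f (as ++ bs) ≡
      laplace (λ d ds → f d (ds ++ bs)) as + alt (length as) * laplace (λ d ds → f d (as ++ ds)) bs
    laplace-++ f []       bs = lemma (laplace f bs)
      where lemma : ∀ x → x ≡ + 0 + + 1 * x
            lemma = solve-∀
    laplace-++ f (a ∷ as) bs rewrite laplace-++ (λ d ds → f d (a ∷ ds)) as bs =
      lemma (f a (as ++ bs)) (laplace (λ d ds → f d (a ∷ ds ++ bs)) as) (alt (length as))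
            (laplace (λ d ds → f d (a ∷ as ++ ds)) bs)
      where lemma : ∀ x y k z → x - (y + k * z) ≡ (x - y) + (- k) * z
            lemma = solve-∀

    laplace-++-zeroʳ : ∀ f as bs → (∀ d ds → d ∈ bs → f d ds ≡ + 0) →
      laplace f (as ++ bs) ≡ laplace (λ d ds → f d (ds ++ bs)) as
    laplace-++-zeroʳ f as bs h = begin
      laplace f (as ++ bs)
        ≡⟨ laplace-++ f as bs ⟩
      laplace (λ d ds → f d (ds ++ bs)) as + alt (length as) * laplace (λ d ds → f d (as ++ ds)) bs
        ≡⟨ cong (λ z → laplace (λ d ds → f d (ds ++ bs)) as + alt (length as) * z)
                (laplace-zero bs (λ d ds d∈bs → h d (as ++ ds) d∈bs)) ⟩
      laplace (λ d ds → f d (ds ++ bs)) as + alt (length as) * + 0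
        ≡⟨ cong (λ z → laplace (λ d ds → f d (ds ++ bs)) as + z) (ℤₚ.*-zeroʳ (alt (length as))) ⟩
      laplace (λ d ds → f d (ds ++ bs)) as + + 0
        ≡⟨ ℤₚ.+-identityʳ _ ⟩
      laplace (λ d ds → f d (ds ++ bs)) as ∎

    laplace-*ˡ : ∀ k f cs → laplace (λ d ds → k * f d ds) cs ≡ k * laplace f cs
    laplace-*ˡ k f []       = sym (ℤₚ.*-zeroʳ k)
    laplace-*ˡ k f (c ∷ cs) rewrite laplace-*ˡ k (λ d ds → f d (c ∷ ds)) cs =
      lemma k (f c cs) (laplace (λ d ds → f d (c ∷ ds)) cs)
      where lemma : ∀ k x y → k * x - k * y ≡ k * (x - y)
            lemma = solve-∀

    laplace-neg : ∀ f cs → laplace (λ d ds → - f d ds) cs ≡ - laplace f cs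
    laplace-neg f cs = begin
      laplace (λ d ds → - f d ds) cs     ≡⟨ laplace-cong cs (λ d ds → sym (ℤₚ.-1*i≡-i (f d ds))) ⟩
      laplace (λ d ds → -1ℤ * f d ds) cs ≡⟨ laplace-*ˡ -1ℤ f cs ⟩
      -1ℤ * laplace f cs                 ≡⟨ ℤₚ.-1*i≡-i _ ⟩
      - laplace f cs                     ∎

    laplace-*ʳ : ∀ k f cs → laplace (λ d ds → f d ds * k) cs ≡ laplace f cs * k
    laplace-*ʳ k f cs = begin
      laplace (λ d ds → f d ds * k) cs ≡⟨ laplace-cong cs (λ d ds → ℤₚ.*-comm (f d ds) k) ⟩
      laplace (λ d ds → k * f d ds) cs ≡⟨ laplace-*ˡ k f cs ⟩
      k * laplace f cs                 ≡⟨ ℤₚ.*-comm k _ ⟩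
      laplace f cs * k                 ∎

    laplace-sub : ∀ f g cs → laplace (λ d ds → f d ds - g d ds) cs ≡ laplace f cs - laplace g cs
    laplace-sub f g []       = refl
    laplace-sub f g (c ∷ cs)
      rewrite laplace-sub (λ d ds → f d (c ∷ ds)) (λ d ds → g d (c ∷ ds)) cs =
      lemma (f c cs) (g c cs) (laplace (λ d ds → f d (c ∷ ds)) cs) (laplace (λ d ds → g d (c ∷ ds)) cs)
      where lemma : ∀ a b x y → (a - b) - (x - y) ≡ (a - x) - (b - y)
            lemma = solve-∀

    laplace-comm : ∀ (F : V → List V → V → List V → ℤ) cs rs →
      laplace (λ d ds → laplace (F d ds) rs) cs ≡ laplace (λ e es → laplace (λ d ds → F d ds e es) cs) rs
    laplace-comm F []       rs = sym (laplace-zero rs (λ _ _ _ → refl))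
    laplace-comm F (c ∷ cs) rs rewrite laplace-comm (λ d ds → F d (c ∷ ds)) cs rs =
      sym (laplace-sub (F c cs) (λ e es → laplace (λ d ds → F d (c ∷ ds) e es) cs) rs)

    minor-expand-column : ∀ M rs c cs → length rs ≡ suc (length cs) →
      minor M rs (c ∷ cs) ≡ laplace (λ r rs′ → M r c * minor M rs′ cs) rs
    minor-expand-column M (r ∷ rs) c cs eq = cong (λ z → M r c * minor M rs cs - z) (begin
      laplace (λ d ds → M r d * minor M rs (c ∷ ds)) cs
        ≡⟨ laplace-cong-∈ cs (λ d ds _ eq′ → cong (M r d *_)
             (minor-expand-column M rs c ds (≡-trans (ℕₚ.suc-injective eq) (sym eq′)))) ⟩
      laplace (λ d ds → M r d * laplace (λ r′ rs′ → M r′ c * minor M rs′ ds) rs) cs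
        ≡⟨ laplace-cong cs (λ d ds → sym (laplace-*ˡ (M r d) _ rs)) ⟩
      laplace (λ d ds → laplace (λ r′ rs′ → M r d * (M r′ c * minor M rs′ ds)) rs) cs
        ≡⟨ laplace-comm (λ d ds r′ rs′ → M r d * (M r′ c * minor M rs′ ds)) cs rs ⟩
      laplace (λ r′ rs′ → laplace (λ d ds → M r d * (M r′ c * minor M rs′ ds)) cs) rs
        ≡⟨ laplace-cong rs (λ r′ rs′ → ≡-trans
             (laplace-cong cs (λ d ds → exchange (M r d) (M r′ c) (minor M rs′ ds)))
             (laplace-*ˡ (M r′ c) (λ d ds → M r d * minor M rs′ ds) cs)) ⟩
      laplace (λ r′ rs′ → M r′ c * minor M (r ∷ rs′) cs) rs ∎)
      where exchange : ∀ a b x → a * (b * x) ≡ b * (a * x)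
            exchange = solve-∀

    minor-transpose : ∀ M rs cs → length rs ≡ length cs → minor M rs cs ≡ minor (flip M) cs rs
    minor-transpose M []       []       _  = refl
    minor-transpose M (r ∷ rs) (c ∷ cs) eq = sym (≡-trans
      (minor-expand-column (flip M) (c ∷ cs) r rs (cong suc (sym (ℕₚ.suc-injective eq))))
      (laplace-cong-∈ (c ∷ cs) (λ d ds _ eq′ → cong (M r d *_) (sym
        (minor-transpose M rs ds (≡-trans (ℕₚ.suc-injective eq) (sym (ℕₚ.suc-injective eq′))))))))

    minor-swap : ∀ M x y rs cs → suc (suc (length rs)) ≡ length cs →
      minor M (y ∷ x ∷ rs) cs ≡ - minor M (x ∷ y ∷ rs) cs
    minor-swap M x y rs (c ∷ cs) eq = begin
      minor M (y ∷ x ∷ rs) (c ∷ cs)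
        ≡⟨ minor-expand-column M (y ∷ x ∷ rs) c cs eq ⟩
      M y c * minor M (x ∷ rs) cs - (M x c * minor M (y ∷ rs) cs - Rest (λ ds → minor M (y ∷ x ∷ ds) cs))
        ≡⟨ cong (λ z → M y c * minor M (x ∷ rs) cs - (M x c * minor M (y ∷ rs) cs - z)) swapped-rest ⟩
      M y c * minor M (x ∷ rs) cs - (M x c * minor M (y ∷ rs) cs - - Rest (λ ds → minor M (x ∷ y ∷ ds) cs))
        ≡⟨ lemma (M y c * minor M (x ∷ rs) cs) (M x c * minor M (y ∷ rs) cs) _ ⟩
      - (M x c * minor M (y ∷ rs) cs - (M y c * minor M (x ∷ rs) cs - Rest (λ ds → minor M (x ∷ y ∷ ds) cs)))
        ≡⟨ cong -_ (sym (minor-expand-column M (x ∷ y ∷ rs) c cs eq)) ⟩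
      - minor M (x ∷ y ∷ rs) (c ∷ cs) ∎
      where
      Rest : (List V → ℤ) → ℤ
      Rest m = laplace (λ d ds → M d c * m ds) rs
      swapped-rest : Rest (λ ds → minor M (y ∷ x ∷ ds) cs) ≡ - Rest (λ ds → minor M (x ∷ y ∷ ds) cs)
      swapped-rest = begin
        Rest (λ ds → minor M (y ∷ x ∷ ds) cs)
          ≡⟨ laplace-cong-∈ rs (λ d ds _ eq′ → cong (M d c *_)
               (minor-swap M x y ds cs (≡-trans (cong suc eq′) (ℕₚ.suc-injective eq)))) ⟩
        laplace (λ d ds → M d c * - minor M (x ∷ y ∷ ds) cs) rs
          ≡⟨ laplace-cong rs (λ d ds → sym (ℤₚ.neg-distribʳ-* (M d c) _)) ⟩
        laplace (λ d ds → - (M d c * minor M (x ∷ y ∷ ds) cs)) rs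
          ≡⟨ laplace-neg _ rs ⟩
        - Rest (λ ds → minor M (x ∷ y ∷ ds) cs) ∎
      lemma : ∀ a b z → a - (b - - z) ≡ - (b - (a - z))
      lemma = solve-∀

    RowsScale : (V → V → ℤ) → List V → List V → ℤ → Set
    RowsScale M rs rs′ ε = ∀ cs → length rs ≡ length cs → minor M rs cs ≡ ε * minor M rs′ cs

    RowsScale-∷ : ∀ M x rs rs′ ε → RowsScale M rs rs′ ε → RowsScale M (x ∷ rs) (x ∷ rs′) ε
    RowsScale-∷ M x rs rs′ ε scale cs eq = begin
      laplace (λ d ds → M x d * minor M rs ds) cs
        ≡⟨ laplace-cong-∈ cs (λ d ds _ eq′ → ≡-trans
             (cong (M x d *_) (scale ds (ℕₚ.suc-injective (≡-trans eq (sym eq′)))))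
             (exchange (M x d) ε (minor M rs′ ds))) ⟩
      laplace (λ d ds → ε * (M x d * minor M rs′ ds)) cs
        ≡⟨ laplace-*ˡ ε (λ d ds → M x d * minor M rs′ ds) cs ⟩
      ε * minor M (x ∷ rs′) cs ∎
      where exchange : ∀ a k b → a * (k * b) ≡ k * (a * b)
            exchange = solve-∀

    ↭⇒RowsScale : ∀ {rs rs′} → rs ↭ rs′ →
      Σ[ ε ∈ ℤ ] ε * ε ≡ + 1 × (∀ M → RowsScale M rs rs′ ε)
    ↭⇒RowsScale refl = + 1 , refl , λ M cs _ → sym (ℤₚ.*-identityˡ _)
    ↭⇒RowsScale {x ∷ rs} {x ∷ rs′} (prep x p) with ↭⇒RowsScale p
    ... | ε , ε²≡1 , scale = ε , ε²≡1 , λ M → RowsScale-∷ M x rs rs′ ε (scale M)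
    ↭⇒RowsScale {x ∷ y ∷ rs} {y ∷ x ∷ rs′} (swap x y p) with ↭⇒RowsScale p
    ... | ε , ε²≡1 , scale = - ε , ≡-trans (square-neg ε) ε²≡1 , λ M cs eq → begin
      minor M (x ∷ y ∷ rs) cs
        ≡⟨ RowsScale-∷ M x (y ∷ rs) (y ∷ rs′) ε (RowsScale-∷ M y rs rs′ ε (scale M)) cs eq ⟩
      ε * minor M (x ∷ y ∷ rs′) cs
        ≡⟨ cong (ε *_) (minor-swap M y x rs′ cs
             (≡-trans (cong (λ k → suc (suc k)) (sym (↭-length p))) eq)) ⟩
      ε * - minor M (y ∷ x ∷ rs′) cs ≡⟨ ℤₚ.neg-distribʳ-* ε _ ⟨
      - (ε * minor M (y ∷ x ∷ rs′) cs) ≡⟨ ℤₚ.neg-distribˡ-* ε _ ⟩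
      - ε * minor M (y ∷ x ∷ rs′) cs ∎
      where square-neg : ∀ a → (- a) * (- a) ≡ a * a
            square-neg = solve-∀
    ↭⇒RowsScale {rs} {rs″} (trans {ys = rs′} p q) with ↭⇒RowsScale p | ↭⇒RowsScale q
    ... | ε₁ , ε₁²≡1 , scale₁ | ε₂ , ε₂²≡1 , scale₂ =
      ε₁ * ε₂ , ≡-trans (square-* ε₁ ε₂) (cong₂ _*_ ε₁²≡1 ε₂²≡1) , λ M cs eq → begin
        minor M rs cs               ≡⟨ scale₁ M cs eq ⟩
        ε₁ * minor M rs′ cs         ≡⟨ cong (ε₁ *_) (scale₂ M cs (≡-trans (sym (↭-length p)) eq)) ⟩
        ε₁ * (ε₂ * minor M rs″ cs)  ≡⟨ ℤₚ.*-assoc ε₁ ε₂ _ ⟨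
        ε₁ * ε₂ * minor M rs″ cs    ∎
      where square-* : ∀ a b → (a * b) * (a * b) ≡ (a * a) * (b * b)
            square-* = solve-∀

    detOn-↭ : ∀ M {xs ys} → xs ↭ ys → detOn M xs ≡ detOn M ys
    detOn-↭ M {xs} {ys} p with ↭⇒RowsScale p
    ... | ε , ε²≡1 , scale = begin
      minor M xs xs                 ≡⟨ scale M xs refl ⟩
      ε * minor M ys xs             ≡⟨ cong (ε *_) (minor-transpose M ys xs (sym (↭-length p))) ⟩
      ε * minor (flip M) xs ys      ≡⟨ cong (ε *_) (scale (flip M) ys (↭-length p)) ⟩
      ε * (ε * minor (flip M) ys ys) ≡⟨ cong (λ z → ε * (ε * z)) (minor-transpose M ys ys refl) ⟨
      ε * (ε * minor M ys ys)       ≡⟨ ℤₚ.*-assoc ε ε _ ⟨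
      ε * ε * minor M ys ys         ≡⟨ cong (_* minor M ys ys) ε²≡1 ⟩
      + 1 * minor M ys ys           ≡⟨ ℤₚ.*-identityˡ _ ⟩
      minor M ys ys                 ∎

    ZeroBlock : (V → V → ℤ) → List V → List V → Set
    ZeroBlock M xs ys = ∀ {x y} → x ∈ xs → y ∈ ys → M x y ≡ + 0

    minor-block-lower : ∀ M xs xs′ ys ys′ → length xs ≡ length xs′ → ZeroBlock M xs ys′ →
      minor M (xs ++ ys) (xs′ ++ ys′) ≡ minor M xs xs′ * minor M ys ys′
    minor-block-lower M []       []        ys ys′ _  _    = sym (ℤₚ.*-identityˡ _)
    minor-block-lower M (x ∷ xs) (c ∷ xs′) ys ys′ eq vanish = begin
      laplace (λ d ds → M x d * minor M (xs ++ ys) ds) ((c ∷ xs′) ++ ys′)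
        ≡⟨ laplace-++-zeroʳ (λ d ds → M x d * minor M (xs ++ ys) ds) (c ∷ xs′) ys′
             (λ d ds d∈ys′ → ≡-trans (cong (_* minor M (xs ++ ys) ds) (vanish (here refl) d∈ys′))
                                     (ℤₚ.*-zeroˡ (minor M (xs ++ ys) ds))) ⟩
      laplace (λ d ds → M x d * minor M (xs ++ ys) (ds ++ ys′)) (c ∷ xs′)
        ≡⟨ laplace-cong-∈ (c ∷ xs′) (λ d ds _ eq′ → ≡-trans
             (cong (M x d *_) (minor-block-lower M xs ds ys ys′
               (≡-trans (ℕₚ.suc-injective eq) (sym (ℕₚ.suc-injective eq′))) (vanish ∘ there)))
             (sym (ℤₚ.*-assoc (M x d) (minor M xs ds) (minor M ys ys′)))) ⟩
      laplace (λ d ds → M x d * minor M xs ds * minor M ys ys′) (c ∷ xs′)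
        ≡⟨ laplace-*ʳ (minor M ys ys′) (λ d ds → M x d * minor M xs ds) (c ∷ xs′) ⟩
      minor M (x ∷ xs) (c ∷ xs′) * minor M ys ys′ ∎

    minor-block-upper : ∀ M xs xs′ ys ys′ → length xs ≡ length xs′ → length ys ≡ length ys′ →
      ZeroBlock M ys xs′ → minor M (xs ++ ys) (xs′ ++ ys′) ≡ minor M xs xs′ * minor M ys ys′
    minor-block-upper M xs xs′ ys ys′ eq₁ eq₂ vanish = begin
      minor M (xs ++ ys) (xs′ ++ ys′)
        ≡⟨ minor-transpose M (xs ++ ys) (xs′ ++ ys′)
             (≡-trans (length-++ xs) (≡-trans (cong₂ ℕ._+_ eq₁ eq₂) (sym (length-++ xs′)))) ⟩
      minor (flip M) (xs′ ++ ys′) (xs ++ ys)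
        ≡⟨ minor-block-lower (flip M) xs′ xs ys′ ys (sym eq₁) (λ x∈xs′ y∈ys → vanish y∈ys x∈xs′) ⟩
      minor (flip M) xs′ xs * minor (flip M) ys′ ys
        ≡⟨ cong₂ _*_ (minor-transpose M xs xs′ eq₁) (minor-transpose M ys ys′ eq₂) ⟨
      minor M xs xs′ * minor M ys ys′ ∎

    minor-rotate : ∀ M as q cs → suc (length as) ≡ length cs →
      minor M (as ++ [ q ]) cs ≡ alt (length as) * minor M (q ∷ as) cs
    minor-rotate M []       q cs _  = sym (ℤₚ.*-identityˡ _)
    minor-rotate M (a ∷ as) q cs eq = begin
      minor M (a ∷ as ++ [ q ]) cs
        ≡⟨ RowsScale-∷ M a (as ++ [ q ]) (q ∷ as) (alt (length as))
             (λ cs′ eq′ → minor-rotate M as q cs′ (≡-trans (sym (length-∷ʳ as)) eq′)) cs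
             (≡-trans (cong suc (length-∷ʳ as)) eq) ⟩
      alt (length as) * minor M (a ∷ q ∷ as) cs
        ≡⟨ cong (alt (length as) *_) (minor-swap M q a as cs eq) ⟩
      alt (length as) * - minor M (q ∷ a ∷ as) cs ≡⟨ ℤₚ.neg-distribʳ-* (alt (length as)) _ ⟨
      - (alt (length as) * minor M (q ∷ a ∷ as) cs) ≡⟨ ℤₚ.neg-distribˡ-* (alt (length as)) _ ⟩
      alt (length (a ∷ as)) * minor M (q ∷ a ∷ as) cs ∎
      where length-∷ʳ : ∀ (xs : List V) → length (xs ++ [ q ]) ≡ suc (length xs)
            length-∷ʳ xs = ≡-trans (length-++ xs) (ℕₚ.+-comm (length xs) 1)

    -- Expanding along the row p, only the columns in p ∷ as and the column q contribute.
    detOn-bridge : ∀ M p q as bs →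
      ZeroBlock M as (q ∷ bs) → ZeroBlock M [ p ] bs → ZeroBlock M bs (p ∷ as) → ZeroBlock M [ q ] as →
      detOn M ((p ∷ as) ++ (q ∷ bs)) ≡
        detOn M (p ∷ as) * detOn M (q ∷ bs) - M p q * M q p * detOn M as * detOn M bs
    detOn-bridge M p q as bs as⊥Y p⊥bs bs⊥X q⊥as = begin
      laplace f (X ++ Y)
        ≡⟨ laplace-++ f X Y ⟩
      laplace (λ d ds → f d (ds ++ Y)) X + alt (length X) * laplace (λ d ds → f d (X ++ ds)) Y
        ≡⟨ cong₂ (λ u v → u + alt (length X) * v) columns-in-X column-q ⟩
      detOn M X * detOn M Y + alt (length X) * (M p q * (alt (length as) * (M q p * detOn M as) * detOn M bs))
        ≡⟨ rearrange (alt (length as)) (detOn M X * detOn M Y) (M p q) (M q p) (detOn M as) (detOn M bs) ⟩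
      detOn M X * detOn M Y - alt (length as) * alt (length as) * (M p q * M q p * detOn M as * detOn M bs)
        ≡⟨ cong (λ u → detOn M X * detOn M Y - u * (M p q * M q p * detOn M as * detOn M bs))
                (alt-square (length as)) ⟩
      detOn M X * detOn M Y - + 1 * (M p q * M q p * detOn M as * detOn M bs)
        ≡⟨ cong (λ u → detOn M X * detOn M Y - u) (ℤₚ.*-identityˡ _) ⟩
      detOn M X * detOn M Y - M p q * M q p * detOn M as * detOn M bs ∎
      where
      X = p ∷ as
      Y = q ∷ bs
      f : V → List V → ℤ
      f d ds = M p d * minor M (as ++ Y) ds

      columns-in-X : laplace (λ d ds → f d (ds ++ Y)) X ≡ detOn M X * detOn M Y
      columns-in-X = begin
        laplace (λ d ds → M p d * minor M (as ++ Y) (ds ++ Y)) X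
          ≡⟨ laplace-cong-∈ X (λ d ds _ eq → ≡-trans
               (cong (M p d *_) (minor-block-lower M as ds Y Y (sym (ℕₚ.suc-injective eq)) as⊥Y))
               (sym (ℤₚ.*-assoc (M p d) (minor M as ds) (detOn M Y)))) ⟩
        laplace (λ d ds → M p d * minor M as ds * detOn M Y) X
          ≡⟨ laplace-*ʳ (detOn M Y) (λ d ds → M p d * minor M as ds) X ⟩
        detOn M X * detOn M Y ∎

      row-q : minor M (q ∷ as) X ≡ M q p * detOn M as
      row-q = begin
        M q p * minor M as as - laplace (λ d ds → M q d * minor M as (p ∷ ds)) as
          ≡⟨ cong (λ u → M q p * minor M as as - u) (laplace-zero as (λ d ds d∈as →
               ≡-trans (cong (_* minor M as (p ∷ ds)) (q⊥as (here refl) d∈as))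
                       (ℤₚ.*-zeroˡ (minor M as (p ∷ ds))))) ⟩
        M q p * minor M as as - + 0
          ≡⟨ ℤₚ.+-identityʳ _ ⟩
        M q p * detOn M as ∎

      minor-without-p-q : minor M (as ++ Y) (X ++ bs) ≡ alt (length as) * (M q p * detOn M as) * detOn M bs
      minor-without-p-q = begin
        minor M (as ++ q ∷ bs) (X ++ bs)
          ≡⟨ cong (λ rs → minor M rs (X ++ bs)) (sym (++-assoc as [ q ] bs)) ⟩
        minor M ((as ++ [ q ]) ++ bs) (X ++ bs)
          ≡⟨ minor-block-upper M (as ++ [ q ]) X bs bs
               (≡-trans (length-++ as) (ℕₚ.+-comm (length as) 1)) refl bs⊥X ⟩
        minor M (as ++ [ q ]) X * detOn M bs
          ≡⟨ cong (_* detOn M bs) (minor-rotate M as q X refl) ⟩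
        alt (length as) * minor M (q ∷ as) X * detOn M bs
          ≡⟨ cong (λ u → alt (length as) * u * detOn M bs) row-q ⟩
        alt (length as) * (M q p * detOn M as) * detOn M bs ∎

      column-q : laplace (λ d ds → f d (X ++ ds)) Y ≡
                 M p q * (alt (length as) * (M q p * detOn M as) * detOn M bs)
      column-q = begin
        f q (X ++ bs) - laplace (λ d ds → f d (X ++ q ∷ ds)) bs
          ≡⟨ cong₂ _-_ (cong (M p q *_) minor-without-p-q) (laplace-zero bs (λ d ds d∈bs →
               ≡-trans (cong (_* minor M (as ++ Y) (X ++ q ∷ ds)) (p⊥bs (here refl) d∈bs))
                       (ℤₚ.*-zeroˡ (minor M (as ++ Y) (X ++ q ∷ ds))))) ⟩
        M p q * (alt (length as) * (M q p * detOn M as) * detOn M bs) - + 0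
          ≡⟨ ℤₚ.+-identityʳ _ ⟩
        M p q * (alt (length as) * (M q p * detOn M as) * detOn M bs) ∎

      rearrange : ∀ a A x y s t →
        A + (- a) * (x * (a * (y * s) * t)) ≡ A - a * a * (x * y * s * t)
      rearrange = solve-∀

    detOn-pendant : ∀ M p q bs → M p p ≡ + 0 → ZeroBlock M [ p ] bs → ZeroBlock M bs [ p ] →
      detOn M (p ∷ q ∷ bs) ≡ - (M p q * M q p * detOn M bs)
    detOn-pendant M p q bs loopless p⊥bs bs⊥p = begin
      detOn M ([ p ] ++ q ∷ bs)
        ≡⟨ detOn-bridge M p q [] bs (λ ()) p⊥bs bs⊥p (λ _ ()) ⟩
      (M p p * + 1 - + 0) * detOn M (q ∷ bs) - M p q * M q p * + 1 * detOn M bs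
        ≡⟨ cong (λ a → (a * + 1 - + 0) * detOn M (q ∷ bs) - M p q * M q p * + 1 * detOn M bs) loopless ⟩
      (+ 0 * + 1 - + 0) * detOn M (q ∷ bs) - M p q * M q p * + 1 * detOn M bs
        ≡⟨ simplify (detOn M (q ∷ bs)) (M p q * M q p) (detOn M bs) ⟩
      - (M p q * M q p * detOn M bs) ∎
      where simplify : ∀ d k e → (+ 0 * + 1 - + 0) * d - k * + 1 * e ≡ - (k * e)
            simplify = solve-∀

    laplace-tabulate : ∀ k f (col : Fin (suc k) → V) →
      laplace f (tabulate col) ≡ ∑ (λ j → alt (toℕ j) * f (col j) (tabulate (col ∘ punchIn j)))
    laplace-tabulate zero    f col = lemma (f (col zero) [])
      where lemma : ∀ x → x - + 0 ≡ + 1 * x + + 0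
            lemma = solve-∀
    laplace-tabulate (suc k) f col =
      cong₂ _+_ (sym (ℤₚ.*-identityˡ (f (col zero) (tabulate (col ∘ suc))))) (begin
      - laplace (λ d ds → f d (col zero ∷ ds)) (tabulate (col ∘ suc))
        ≡⟨ cong -_ (laplace-tabulate k (λ d ds → f d (col zero ∷ ds)) (col ∘ suc)) ⟩
      - ∑ (λ j → alt (toℕ j) * F j)
        ≡⟨ ∑-neg (λ j → alt (toℕ j) * F j) ⟨
      ∑ (λ j → - (alt (toℕ j) * F j))
        ≡⟨ ∑-cong (λ j → ℤₚ.neg-distribˡ-* (alt (toℕ j)) (F j)) ⟩
      ∑ (λ j → - alt (toℕ j) * F j) ∎)
      where F : Fin (suc k) → ℤ
            F j = f (col (suc j)) (col zero ∷ tabulate (col ∘ suc ∘ punchIn j))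

    det≡minor : ∀ n (M : V → V → ℤ) (row col : Fin n → V) →
      det (λ i j → M (row i) (col j)) ≡ minor M (tabulate row) (tabulate col)
    det≡minor zero    M row col = refl
    det≡minor (suc n) M row col = begin
      ∑ (λ j → alt (toℕ j) * M (row zero) (col j) * det (λ r c → M (row (suc r)) (col (punchIn j c))))
        ≡⟨ ∑-cong (λ j → ≡-trans
             (cong (alt (toℕ j) * M (row zero) (col j) *_) (det≡minor n M (row ∘ suc) (col ∘ punchIn j)))
             (ℤₚ.*-assoc (alt (toℕ j)) _ _)) ⟩
      ∑ (λ j → alt (toℕ j) *
               (M (row zero) (col j) * minor M (tabulate (row ∘ suc)) (tabulate (col ∘ punchIn j))))
        ≡⟨ laplace-tabulate n (λ d ds → M (row zero) d * minor M (tabulate (row ∘ suc)) ds) col ⟨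
      minor M (tabulate row) (tabulate col) ∎

  det-induced : ∀ {n} (M : Mat n) xs → det (induced M xs) ≡ detOn M xs
  det-induced M xs = ≡-trans (det≡minor (length xs) M (lookup xs) (lookup xs))
                             (cong₂ (minor M) (tabulate-lookup xs) (tabulate-lookup xs))

module TabulatedLists {A : Set} where

  open import Data.Nat using (zero; suc; _+_; _≤_; _<_; z≤n; s≤s)
  open import Data.Fin using (Fin; zero; suc; toℕ; punchIn; _↑ˡ_; _↑ʳ_)
  open import Data.Fin.Properties using (punchInᵢ≢i)
  open import Data.List using (_∷_; _++_; tabulate; take; drop)
  open import Data.List.Membership.Propositional using (_∈_)
  open import Data.List.Membership.Propositional.Properties using (∈-tabulate⁻)
  open import Data.List.Relation.Unary.Any using (here; there)
  open import Data.List.Relation.Binary.Permutation.Propositional using (_↭_; refl; prep; swap; trans)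
  open import Data.Product using (Σ-syntax; _×_; _,_)
  open import Function using (_∘_)
  open import Relation.Binary.PropositionalEquality using (_≡_; _≢_; refl; cong)

  tabulate-++ : ∀ m n (f : Fin (m + n) → A) →
    tabulate f ≡ tabulate (f ∘ (_↑ˡ n)) ++ tabulate (f ∘ (m ↑ʳ_))
  tabulate-++ zero    n f = refl
  tabulate-++ (suc m) n f = cong (f zero ∷_) (tabulate-++ m n (f ∘ suc))

  tabulate-↭-pick : ∀ {n} (f : Fin (suc n) → A) r → tabulate f ↭ f r ∷ tabulate (f ∘ punchIn r)
  tabulate-↭-pick         f zero    = refl
  tabulate-↭-pick {suc n} f (suc r) = trans (prep (f zero) (tabulate-↭-pick (f ∘ suc) r))
                                            (swap (f zero) (f (suc r)) refl)

  drop-tabulate : ∀ {n} (f : Fin n → A) i →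
    drop (toℕ i) (tabulate f) ≡ f i ∷ drop (suc (toℕ i)) (tabulate f)
  drop-tabulate f zero    = refl
  drop-tabulate f (suc i) = drop-tabulate (f ∘ suc) i

  ∈-punched⁻ : ∀ {n} (f : Fin (suc n) → A) r {x} → x ∈ tabulate (f ∘ punchIn r) →
    Σ[ i ∈ Fin (suc n) ] x ≡ f i × i ≢ r
  ∈-punched⁻ f r x∈ with ∈-tabulate⁻ {f = f ∘ punchIn r} x∈
  ... | j , refl = punchIn r j , refl , punchInᵢ≢i r j

  ∈-take-tabulate⁻ : ∀ {n} (f : Fin n → A) t {x} → x ∈ take t (tabulate f) →
    Σ[ i ∈ Fin n ] x ≡ f i × toℕ i < t
  ∈-take-tabulate⁻ {suc n} f (suc t) (here refl) = zero , refl , s≤s z≤n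
  ∈-take-tabulate⁻ {suc n} f (suc t) (there x∈) with ∈-take-tabulate⁻ (f ∘ suc) t x∈
  ... | i , refl , i<t = suc i , refl , s≤s i<t

  ∈-drop-tabulate⁻ : ∀ {n} (f : Fin n → A) d {x} → x ∈ drop d (tabulate f) →
    Σ[ i ∈ Fin n ] x ≡ f i × d ≤ toℕ i
  ∈-drop-tabulate⁻ f zero x∈ with ∈-tabulate⁻ x∈
  ... | i , refl = i , refl , z≤n
  ∈-drop-tabulate⁻ {suc n} f (suc d) x∈ with ∈-drop-tabulate⁻ (f ∘ suc) d x∈
  ... | i , refl , d≤i = suc i , refl , s≤s d≤i

  ∈-picked⁻ : ∀ {n} (f : Fin (suc n) → A) r {x} → x ∈ f r ∷ tabulate (f ∘ punchIn r) →
    Σ[ i ∈ Fin (suc n) ] x ≡ f i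
  ∈-picked⁻ f r (here refl) = r , refl
  ∈-picked⁻ f r (there x∈) with ∈-punched⁻ f r x∈
  ... | i , refl , _ = i , refl

module Unicyclic where

  open import Data.Nat as ℕ using (ℕ; zero; suc; _≡ᵇ_; _≤_; _<_; z≤n; s≤s)
  open import Data.Nat.Properties using (_≟_; suc-injective; 0≢1+n; 1+n≢n; <⇒≢; ≤-<-trans; <-trans; n<1+n)
  open import Data.Fin as Fin using (Fin; zero; suc; toℕ; punchIn; splitAt; _↑ˡ_; _↑ʳ_)
  open import Data.Fin.Properties using (splitAt-↑ˡ; splitAt-↑ʳ; toℕ<n)
  open import Data.Bool using (false; _∧_; _∨_)
  open import Data.Bool.Properties using (∧-zeroʳ)
  open import Data.Integer using (ℤ; +_; -_; _+_; _*_; _-_)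
  open import Data.Integer.Tactic.RingSolver using (solve-∀)
  open import Data.List using (List; [_]; _∷_; _++_; tabulate; take; drop)
  open import Data.List.Properties using (++-assoc; take++drop≡id)
  open import Data.List.Membership.Propositional using (_∈_)
  open import Data.List.Membership.Propositional.Properties using (∈-++⁻; ∈-tabulate⁻)
  open import Data.List.Relation.Unary.Any using (here; there)
  open import Data.List.Relation.Binary.Permutation.Propositional
    using (_↭_; prep; ↭-sym; ↭-reflexive) renaming (trans to ↭-trans)
  open import Data.List.Relation.Binary.Permutation.Propositional.Properties using (++⁺ˡ; ++⁺ʳ; ++-comm; shift)
  open import Data.Empty using (⊥-elim)
  open import Data.Product using (Σ-syntax; _×_; _,_)
  open import Data.Sum using (_⊎_; inj₁; inj₂)
  import Data.Sum as Sum
  open import Function using (_∘_; id)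
  open import Relation.Nullary using (yes; no; does)
  open import Relation.Nullary.Decidable using (dec-false)
  open import Relation.Binary.PropositionalEquality
    using (_≡_; _≢_; refl; trans; sym; cong; cong₂; module ≡-Reasoning)
  open import Defs
  open ListDeterminant
  open TabulatedLists

  ≡ᵇ-false : ∀ {m n} → m ≢ n → (m ≡ᵇ n) ≡ false
  ≡ᵇ-false {m} {n} = dec-false (m ≟ n)

  nextB-false : ∀ {n} (i j : Fin n) → suc (toℕ i) ≢ toℕ j → (suc (toℕ i) ≡ n → toℕ j ≢ 0) →
    nextB i j ≡ false
  nextB-false {n} i j i+1≢j wraps = cong₂ _∨_ (≡ᵇ-false i+1≢j) wrap-false
    where
    wrap-false : ((suc (toℕ i) ≡ᵇ n) ∧ (toℕ j ≡ᵇ 0)) ≡ false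
    wrap-false with suc (toℕ i) ≟ n
    ... | yes i+1≡n = trans (cong ((suc (toℕ i) ≡ᵇ n) ∧_) (≡ᵇ-false (wraps i+1≡n))) (∧-zeroʳ _)
    ... | no  i+1≢n = cong (_∧ (toℕ j ≡ᵇ 0)) (≡ᵇ-false i+1≢n)

  cycAdj-zero : ∀ {n} (σ : Fin n → ℤ) i j → nextB i j ≡ false → nextB j i ≡ false →
    cycAdj σ i j ≡ + 0
  cycAdj-zero σ i j i↛j j↛i rewrite i↛j | j↛i = refl

  cycAdj-loopless : ∀ {k} (σ : Fin (suc (suc k)) → ℤ) i → cycAdj σ i i ≡ + 0
  cycAdj-loopless σ i = cycAdj-zero σ i i no-loop no-loop
    where no-loop : nextB i i ≡ false
          no-loop = nextB-false i i 1+n≢n (λ i+1≡n i≡0 → 0≢1+n (trans (sym i≡0) (suc-injective i+1≡n)))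

  joinE-off : ∀ {n m} (v : Fin n) (r : Fin m) s i a → i ≢ v ⊎ a ≢ r → joinE v r s i a ≡ + 0
  joinE-off v r s i a (inj₁ i≢v) rewrite dec-false (i Fin.≟ v) i≢v = refl
  joinE-off v r s i a (inj₂ a≢r) rewrite dec-false (a Fin.≟ r) a≢r | ∧-zeroʳ (does (i Fin.≟ v)) = refl

  -- The cycle has 2 + k vertices, v₁ is vertex 0 and v_{l+1} is vertex suc w′.
  module TwoTreesOnACycle
    (k k₁ k₂ : ℕ) (σ : Fin (suc (suc k)) → ℤ) (T₁ : Mat (suc k₁)) (T₂ : Mat (suc k₂))
    (r₁ : Fin (suc k₁)) (r₂ : Fin (suc k₂)) (w′ : Fin (suc k)) (s₁ s₂ : ℤ) where

    open ≡-Reasoning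

    n m₁ m₂ : ℕ
    n  = suc (suc k)
    m₁ = suc k₁
    m₂ = suc k₂

    N : ℕ
    N = n ℕ.+ (m₁ ℕ.+ m₂)

    V : Set
    V = Fin N

    w : Fin n
    w = suc w′

    U : Mat N
    U = unicyclic σ T₁ T₂ r₁ r₂ zero w s₁ s₂

    c : Fin n → V
    c = cyc m₁ m₂

    τ₁ : Fin m₁ → V
    τ₁ = t₁ n m₂

    τ₂ : Fin m₂ → V
    τ₂ = t₂ n m₁

    classify-c : ∀ i → classify {n} {m₁} {m₂} (c i) ≡ inj₁ i
    classify-c i = cong (Sum.map₂ (splitAt m₁)) (splitAt-↑ˡ n i (m₁ ℕ.+ m₂))

    classify-τ₁ : ∀ a → classify {n} {m₁} {m₂} (τ₁ a) ≡ inj₂ (inj₁ a)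
    classify-τ₁ a = trans (cong (Sum.map₂ (splitAt m₁)) (splitAt-↑ʳ n (m₁ ℕ.+ m₂) (a ↑ˡ m₂)))
                          (cong inj₂ (splitAt-↑ˡ m₁ a m₂))

    classify-τ₂ : ∀ a → classify {n} {m₁} {m₂} (τ₂ a) ≡ inj₂ (inj₂ a)
    classify-τ₂ a = trans (cong (Sum.map₂ (splitAt m₁)) (splitAt-↑ʳ n (m₁ ℕ.+ m₂) (m₁ ↑ʳ a)))
                          (cong inj₂ (splitAt-↑ʳ m₁ m₂ a))

    U-entry : ∀ x y {X Y} → classify x ≡ X → classify y ≡ Y →
      U x y ≡ adj⊎ σ T₁ T₂ r₁ r₂ zero w s₁ s₂ X Y
    U-entry x y = cong₂ (adj⊎ σ T₁ T₂ r₁ r₂ zero w s₁ s₂)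

    c-c : ∀ i j → U (c i) (c j) ≡ cycAdj σ i j
    c-c i j = U-entry (c i) (c j) (classify-c i) (classify-c j)

    c-τ₁-off : ∀ i a → i ≢ zero ⊎ a ≢ r₁ → U (c i) (τ₁ a) ≡ + 0
    c-τ₁-off i a off =
      trans (U-entry (c i) (τ₁ a) (classify-c i) (classify-τ₁ a)) (joinE-off zero r₁ s₁ i a off)

    τ₁-c-off : ∀ a i → i ≢ zero ⊎ a ≢ r₁ → U (τ₁ a) (c i) ≡ + 0
    τ₁-c-off a i off =
      trans (U-entry (τ₁ a) (c i) (classify-τ₁ a) (classify-c i)) (joinE-off zero r₁ s₁ i a off)

    c-τ₂-off : ∀ i a → i ≢ w ⊎ a ≢ r₂ → U (c i) (τ₂ a) ≡ + 0
    c-τ₂-off i a off =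
      trans (U-entry (c i) (τ₂ a) (classify-c i) (classify-τ₂ a)) (joinE-off w r₂ s₂ i a off)

    τ₂-c-off : ∀ a i → i ≢ w ⊎ a ≢ r₂ → U (τ₂ a) (c i) ≡ + 0
    τ₂-c-off a i off =
      trans (U-entry (τ₂ a) (c i) (classify-τ₂ a) (classify-c i)) (joinE-off w r₂ s₂ i a off)

    τ₁-τ₂ : ∀ a b → U (τ₁ a) (τ₂ b) ≡ + 0
    τ₁-τ₂ a b = U-entry (τ₁ a) (τ₂ b) (classify-τ₁ a) (classify-τ₂ b)

    τ₂-τ₁ : ∀ b a → U (τ₂ b) (τ₁ a) ≡ + 0
    τ₂-τ₁ b a = U-entry (τ₂ b) (τ₁ a) (classify-τ₂ b) (classify-τ₁ a)

    τ₁-τ₁ : ∀ a b → U (τ₁ a) (τ₁ b) ≡ T₁ a b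
    τ₁-τ₁ a b = U-entry (τ₁ a) (τ₁ b) (classify-τ₁ a) (classify-τ₁ b)

    τ₂-τ₂ : ∀ a b → U (τ₂ a) (τ₂ b) ≡ T₂ a b
    τ₂-τ₂ a b = U-entry (τ₂ a) (τ₂ b) (classify-τ₂ a) (classify-τ₂ b)

    v₁ vₗ₊₁ ρ₁ ρ₂ : V
    v₁   = c zero
    vₗ₊₁ = c w
    ρ₁   = τ₁ r₁
    ρ₂   = τ₂ r₂

    -- path, pathL, pathR are P_{n-1}, P_{l-1}, P_{n-l-1}; treeᵢ° is Tᵢ without its root.
    cycle path pathL pathR tree₁ tree₂ tree₁° tree₂° : List V
    cycle  = tabulate c
    path   = tabulate (c ∘ suc)
    pathL  = take (toℕ w′) path
    pathR  = drop (suc (toℕ w)) cycle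
    tree₁  = tabulate τ₁
    tree₂  = tabulate τ₂
    tree₁° = tabulate (τ₁ ∘ punchIn r₁)
    tree₂° = tabulate (τ₂ ∘ punchIn r₂)

    ∈-path⁻ : ∀ {x} → x ∈ path → Σ[ i ∈ Fin n ] x ≡ c i × i ≢ zero
    ∈-path⁻ x∈ with ∈-tabulate⁻ {f = c ∘ suc} x∈
    ... | j , refl = suc j , refl , λ ()

    ∈-pathL⁻ : ∀ {x} → x ∈ pathL → Σ[ i ∈ Fin n ] x ≡ c i × 1 ≤ toℕ i × toℕ i < toℕ w
    ∈-pathL⁻ x∈ with ∈-take-tabulate⁻ (c ∘ suc) (toℕ w′) x∈
    ... | j , refl , j<w′ = suc j , refl , s≤s z≤n , s≤s j<w′

    ∈-pathR⁻ : ∀ {x} → x ∈ pathR → Σ[ i ∈ Fin n ] x ≡ c i × toℕ w < toℕ i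
    ∈-pathR⁻ = ∈-drop-tabulate⁻ c (suc (toℕ w))

    ∈-pathL∪pathR⁻ : ∀ {x} → x ∈ pathL ++ pathR → Σ[ i ∈ Fin n ] x ≡ c i × i ≢ w
    ∈-pathL∪pathR⁻ x∈ with ∈-++⁻ pathL x∈
    ... | inj₁ x∈L with ∈-pathL⁻ x∈L
    ...   | i , refl , _ , i<w = i , refl , λ i≡w → <⇒≢ i<w (cong toℕ i≡w)
    ∈-pathL∪pathR⁻ x∈ | inj₂ x∈R with ∈-pathR⁻ x∈R
    ...   | i , refl , w<i = i , refl , λ i≡w → <⇒≢ w<i (cong toℕ (sym i≡w))

    ∈-path∪tree₂⁻ : ∀ {x} → x ∈ path ++ tree₂ →
      (Σ[ i ∈ Fin n ] x ≡ c i × i ≢ zero) ⊎ (Σ[ b ∈ Fin m₂ ] x ≡ τ₂ b)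
    ∈-path∪tree₂⁻ x∈ with ∈-++⁻ path x∈
    ... | inj₁ x∈path = inj₁ (∈-path⁻ x∈path)
    ... | inj₂ x∈tree = inj₂ (∈-tabulate⁻ {f = τ₂} x∈tree)

    ∈-cycle∪tree₂⁻ : ∀ {x} → x ∈ cycle ++ tree₂ →
      (Σ[ i ∈ Fin n ] x ≡ c i) ⊎ (Σ[ b ∈ Fin m₂ ] x ≡ τ₂ b)
    ∈-cycle∪tree₂⁻ x∈ with ∈-++⁻ cycle x∈
    ... | inj₁ x∈cycle = inj₁ (∈-tabulate⁻ {f = c} x∈cycle)
    ... | inj₂ x∈tree  = inj₂ (∈-tabulate⁻ {f = τ₂} x∈tree)

    path∪tree₂⊥tree₁ : ZeroBlock U (path ++ tree₂) (ρ₁ ∷ tree₁°)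
    path∪tree₂⊥tree₁ x∈ y∈ with ∈-path∪tree₂⁻ x∈ | ∈-picked⁻ τ₁ r₁ y∈
    ... | inj₁ (i , refl , i≢0) | a , refl = c-τ₁-off i a (inj₁ i≢0)
    ... | inj₂ (b , refl)       | a , refl = τ₂-τ₁ b a

    v₁⊥tree₁° : ZeroBlock U [ v₁ ] tree₁°
    v₁⊥tree₁° (here refl) y∈ with ∈-punched⁻ τ₁ r₁ y∈
    ... | a , refl , a≢r₁ = c-τ₁-off zero a (inj₂ a≢r₁)

    tree₁°⊥cycle∪tree₂ : ZeroBlock U tree₁° (cycle ++ tree₂)
    tree₁°⊥cycle∪tree₂ y∈ x∈ with ∈-punched⁻ τ₁ r₁ y∈ | ∈-cycle∪tree₂⁻ x∈
    ... | a , refl , a≢r₁ | inj₁ (i , refl) = τ₁-c-off a i (inj₂ a≢r₁)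
    ... | a , refl , _    | inj₂ (b , refl) = τ₁-τ₂ a b

    tree₁°⊥v₁ : ZeroBlock U tree₁° [ v₁ ]
    tree₁°⊥v₁ y∈ (here refl) = tree₁°⊥cycle∪tree₂ y∈ (here refl)

    ρ₁⊥path∪tree₂ : ZeroBlock U [ ρ₁ ] (path ++ tree₂)
    ρ₁⊥path∪tree₂ (here refl) x∈ with ∈-path∪tree₂⁻ x∈
    ... | inj₁ (i , refl , i≢0) = τ₁-c-off r₁ i (inj₁ i≢0)
    ... | inj₂ (b , refl)       = τ₁-τ₂ r₁ b

    pathL∪pathR⊥tree₂ : ZeroBlock U (pathL ++ pathR) (ρ₂ ∷ tree₂°)
    pathL∪pathR⊥tree₂ x∈ y∈ with ∈-pathL∪pathR⁻ x∈ | ∈-picked⁻ τ₂ r₂ y∈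
    ... | i , refl , i≢w | a , refl = c-τ₂-off i a (inj₁ i≢w)

    vₗ₊₁⊥tree₂° : ZeroBlock U [ vₗ₊₁ ] tree₂°
    vₗ₊₁⊥tree₂° (here refl) y∈ with ∈-punched⁻ τ₂ r₂ y∈
    ... | a , refl , a≢r₂ = c-τ₂-off w a (inj₂ a≢r₂)

    tree₂°⊥c : ∀ {y} i → y ∈ tree₂° → U y (c i) ≡ + 0
    tree₂°⊥c i y∈ with ∈-punched⁻ τ₂ r₂ y∈
    ... | a , refl , a≢r₂ = τ₂-c-off a i (inj₂ a≢r₂)

    tree₂°⊥vₗ₊₁∪pathL∪pathR : ZeroBlock U tree₂° (vₗ₊₁ ∷ pathL ++ pathR)
    tree₂°⊥vₗ₊₁∪pathL∪pathR y∈ (here refl) = tree₂°⊥c w y∈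
    tree₂°⊥vₗ₊₁∪pathL∪pathR y∈ (there x∈) with ∈-pathL∪pathR⁻ x∈
    ... | i , refl , _ = tree₂°⊥c i y∈

    tree₂°⊥vₗ₊₁ : ZeroBlock U tree₂° [ vₗ₊₁ ]
    tree₂°⊥vₗ₊₁ y∈ (here refl) = tree₂°⊥c w y∈

    ρ₂⊥pathL∪pathR : ZeroBlock U [ ρ₂ ] (pathL ++ pathR)
    ρ₂⊥pathL∪pathR (here refl) x∈ with ∈-pathL∪pathR⁻ x∈
    ... | i , refl , i≢w = τ₂-c-off r₂ i (inj₁ i≢w)

    pathL⊥pathR : ZeroBlock U pathL pathR
    pathL⊥pathR x∈ y∈ with ∈-pathL⁻ x∈ | ∈-pathR⁻ y∈
    ... | i , refl , 1≤i , i<w | j , refl , w<j = trans (c-c i j) (cycAdj-zero σ i j i↛j j↛i)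
      where
      i+1<j : suc (toℕ i) < toℕ j
      i+1<j = ≤-<-trans i<w w<j
      i<j+1 : toℕ i < suc (toℕ j)
      i<j+1 = <-trans (n<1+n (toℕ i)) (<-trans i+1<j (n<1+n (toℕ j)))
      i↛j : nextB i j ≡ false
      i↛j = nextB-false i j (<⇒≢ i+1<j) (λ i+1≡n → ⊥-elim (<⇒≢ (<-trans i+1<j (toℕ<n j)) i+1≡n))
      j↛i : nextB j i ≡ false
      j↛i = nextB-false j i (λ j+1≡i → <⇒≢ i<j+1 (sym j+1≡i)) (λ _ i≡0 → <⇒≢ 1≤i (sym i≡0))

    vertices↭ : cycle ++ tree₁ ++ tree₂ ↭ (cycle ++ tree₂) ++ ρ₁ ∷ tree₁°
    vertices↭ = ↭-trans (++⁺ˡ cycle (++-comm tree₁ tree₂)) (↭-trans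
      (↭-reflexive (sym (++-assoc cycle tree₂ tree₁))) (++⁺ˡ (cycle ++ tree₂) (tabulate-↭-pick τ₁ r₁)))

    path↭ : path ↭ vₗ₊₁ ∷ pathL ++ pathR
    path↭ = ↭-trans (↭-reflexive path-split) (shift vₗ₊₁ pathL pathR)
      where path-split : path ≡ pathL ++ vₗ₊₁ ∷ pathR
            path-split = trans (sym (take++drop≡id (toℕ w′) path))
                               (cong (pathL ++_) (drop-tabulate (c ∘ suc) w′))

    path∪tree₂↭ : path ++ tree₂ ↭ (vₗ₊₁ ∷ pathL ++ pathR) ++ ρ₂ ∷ tree₂°
    path∪tree₂↭ = ↭-trans (++⁺ʳ tree₂ path↭) (++⁺ˡ (vₗ₊₁ ∷ pathL ++ pathR) (tabulate-↭-pick τ₂ r₂))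

    D : List V → ℤ
    D = detOn U

    K₁ K₂ : ℤ
    K₁ = U v₁ ρ₁ * U ρ₁ v₁
    K₂ = U vₗ₊₁ ρ₂ * U ρ₂ vₗ₊₁

    det-U : det U ≡ D (cycle ++ tree₁ ++ tree₂)
    det-U = trans (det≡minor N U id id) (cong₂ (minor U) all-vertices all-vertices)
      where all-vertices : tabulate id ≡ cycle ++ tree₁ ++ tree₂
            all-vertices = trans (tabulate-++ n (m₁ ℕ.+ m₂) id)
                                 (cong (cycle ++_) (tabulate-++ m₁ m₂ (n ↑ʳ_)))

    det-T₁ : det T₁ ≡ D tree₁
    det-T₁ = trans (det-cong (λ a b → sym (τ₁-τ₁ a b))) (det≡minor m₁ U τ₁ τ₁)

    det-T₂ : det T₂ ≡ D tree₂
    det-T₂ = trans (det-cong (λ a b → sym (τ₂-τ₂ a b))) (det≡minor m₂ U τ₂ τ₂)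

    split-at-v₁ : det U ≡ D (cycle ++ tree₂) * D tree₁ - K₁ * D (path ++ tree₂) * D tree₁°
    split-at-v₁ = begin
      det U                                  ≡⟨ det-U ⟩
      D (cycle ++ tree₁ ++ tree₂)            ≡⟨ detOn-↭ U vertices↭ ⟩
      D ((cycle ++ tree₂) ++ ρ₁ ∷ tree₁°)
        ≡⟨ detOn-bridge U v₁ ρ₁ (path ++ tree₂) tree₁°
             path∪tree₂⊥tree₁ v₁⊥tree₁° tree₁°⊥cycle∪tree₂ ρ₁⊥path∪tree₂ ⟩
      D (cycle ++ tree₂) * D (ρ₁ ∷ tree₁°) - K₁ * D (path ++ tree₂) * D tree₁°
        ≡⟨ cong (λ d → D (cycle ++ tree₂) * d - K₁ * D (path ++ tree₂) * D tree₁°)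
                (detOn-↭ U (↭-sym (tabulate-↭-pick τ₁ r₁))) ⟩
      D (cycle ++ tree₂) * D tree₁ - K₁ * D (path ++ tree₂) * D tree₁° ∎

    split-at-vₗ₊₁ : D (path ++ tree₂) ≡ D path * D tree₂ - K₂ * (D pathL * D pathR) * D tree₂°
    split-at-vₗ₊₁ = begin
      D (path ++ tree₂)                     ≡⟨ detOn-↭ U path∪tree₂↭ ⟩
      D ((vₗ₊₁ ∷ pathL ++ pathR) ++ ρ₂ ∷ tree₂°)
        ≡⟨ detOn-bridge U vₗ₊₁ ρ₂ (pathL ++ pathR) tree₂°
             pathL∪pathR⊥tree₂ vₗ₊₁⊥tree₂° tree₂°⊥vₗ₊₁∪pathL∪pathR ρ₂⊥pathL∪pathR ⟩
      D (vₗ₊₁ ∷ pathL ++ pathR) * D (ρ₂ ∷ tree₂°) - K₂ * D (pathL ++ pathR) * D tree₂°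
        ≡⟨ cong₂ (λ d e → d - K₂ * e * D tree₂°)
             (cong₂ _*_ (detOn-↭ U (↭-sym path↭)) (detOn-↭ U (↭-sym (tabulate-↭-pick τ₂ r₂))))
             (minor-block-lower U pathL pathL pathR pathR refl pathL⊥pathR) ⟩
      D path * D tree₂ - K₂ * (D pathL * D pathR) * D tree₂° ∎

    pendant-v₁ : D (v₁ ∷ tree₁) ≡ - (K₁ * D tree₁°)
    pendant-v₁ = trans (detOn-↭ U (prep v₁ (tabulate-↭-pick τ₁ r₁)))
      (detOn-pendant U v₁ ρ₁ tree₁° (trans (c-c zero zero) (cycAdj-loopless σ zero)) v₁⊥tree₁° tree₁°⊥v₁)

    pendant-vₗ₊₁ : D (vₗ₊₁ ∷ tree₂) ≡ - (K₂ * D tree₂°)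
    pendant-vₗ₊₁ = trans (detOn-↭ U (prep vₗ₊₁ (tabulate-↭-pick τ₂ r₂)))
      (detOn-pendant U vₗ₊₁ ρ₂ tree₂° (trans (c-c w w) (cycAdj-loopless σ w)) vₗ₊₁⊥tree₂° tree₂°⊥vₗ₊₁)

    det-formula : (List V → ℤ) → List V → List V → List V → ℤ → ℤ → ℤ
    det-formula d cs ts₁ ts₂ t₁ t₂ =
      (d (cs ++ ts₂) * t₁
        + d (v₁ ∷ ts₁) * d (vₗ₊₁ ∷ ts₂) * d (take (toℕ w′) (drop 1 cs)) * d (drop (suc (toℕ w)) cs))
      + d (v₁ ∷ ts₁) * t₂ * d (drop 1 cs)

    det-formula-cong : ∀ {d d′} cs ts₁ ts₂ {t₁ t₁′ t₂ t₂′} →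
      (∀ xs → d xs ≡ d′ xs) → t₁ ≡ t₁′ → t₂ ≡ t₂′ →
      det-formula d cs ts₁ ts₂ t₁ t₂ ≡ det-formula d′ cs ts₁ ts₂ t₁′ t₂′
    det-formula-cong cs ts₁ ts₂ eq refl refl
      rewrite eq (cs ++ ts₂) | eq (v₁ ∷ ts₁) | eq (vₗ₊₁ ∷ ts₂)
            | eq (take (toℕ w′) (drop 1 cs)) | eq (drop (suc (toℕ w)) cs) | eq (drop 1 cs) = refl

    -- Stated up to equality of vertex lists so that it also covers the map/allFin lists of theorem10.
    det-unicyclic : ∀ {cs ts₁ ts₂} → cs ≡ cycle → ts₁ ≡ tree₁ → ts₂ ≡ tree₂ →
      det U ≡ det-formula (λ xs → det (induced U xs)) cs ts₁ ts₂ (det T₁) (det T₂)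
    det-unicyclic refl refl refl = begin
      det U
        ≡⟨ split-at-v₁ ⟩
      D (cycle ++ tree₂) * D tree₁ - K₁ * D (path ++ tree₂) * D tree₁°
        ≡⟨ cong (λ d → D (cycle ++ tree₂) * D tree₁ - K₁ * d * D tree₁°) split-at-vₗ₊₁ ⟩
      D (cycle ++ tree₂) * D tree₁ - K₁ * (D path * D tree₂ - K₂ * (D pathL * D pathR) * D tree₂°) * D tree₁°
        ≡⟨ regroup (D (cycle ++ tree₂)) (D tree₁) K₁ (D path) (D tree₂) K₂
                   (D pathL) (D pathR) (D tree₂°) (D tree₁°) ⟩
      (D (cycle ++ tree₂) * D tree₁ + - (K₁ * D tree₁°) * - (K₂ * D tree₂°) * D pathL * D pathR)
        + - (K₁ * D tree₁°) * D tree₂ * D path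
        ≡⟨ cong₂ (λ a b → (D (cycle ++ tree₂) * D tree₁ + a * b * D pathL * D pathR) + a * D tree₂ * D path)
                 pendant-v₁ pendant-vₗ₊₁ ⟨
      det-formula D cycle tree₁ tree₂ (D tree₁) (D tree₂)
        ≡⟨ det-formula-cong cycle tree₁ tree₂ (λ xs → sym (det-induced U xs)) (sym det-T₁) (sym det-T₂) ⟩
      det-formula (λ xs → det (induced U xs)) cycle tree₁ tree₂ (det T₁) (det T₂) ∎
      where
      regroup : ∀ a t₁ k₁ p t₂ k₂ x y r₂ r₁ →
        a * t₁ - k₁ * (p * t₂ - k₂ * (x * y) * r₂) * r₁ ≡
        (a * t₁ + - (k₁ * r₁) * - (k₂ * r₂) * x * y) + - (k₁ * r₁) * t₂ * p
      regroup = solve-∀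

open import Defs
open import Data.Nat using (ℕ; zero; suc; _≤_; _+_; _∸_; s≤s)
open import Data.Integer using (ℤ) renaming (_+_ to _+ℤ_; _*_ to _*ℤ_)
open import Data.Fin using (Fin; zero; suc; toℕ)
open import Data.List using (_∷_; map; allFin; _++_; take; drop)
open import Data.List.Properties using (map-tabulate)
open import Function using (id)
open import Relation.Binary.PropositionalEquality using (_≡_; refl)

theorem10 : (n m₁ m₂ l : ℕ) (σ : Fin n → ℤ) (T₁ : Mat m₁) (T₂ : Mat m₂)
    (r₁ : Fin m₁) (r₂ : Fin m₂) (v₁ w : Fin n) (s₁ s₂ : ℤ) →
    3 ≤ n → (∀ i → IsSign (σ i)) →
    IsSignedTree T₁ → IsSignedTree T₂ → IsSign s₁ → IsSign s₂ →
    toℕ v₁ ≡ 0 → toℕ w ≡ l → 1 ≤ l → l + l ≤ n →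
    let U = unicyclic σ T₁ T₂ r₁ r₂ v₁ w s₁ s₂
        C = map (cyc m₁ m₂) (allFin n)
    in det U ≡
       (det (induced U (C ++ map (t₂ n m₁) (allFin m₂))) *ℤ det T₁
       +ℤ det (induced U (cyc m₁ m₂ v₁ ∷ map (t₁ n m₂) (allFin m₁)))
          *ℤ det (induced U (cyc m₁ m₂ w ∷ map (t₂ n m₁) (allFin m₂)))
          *ℤ det (induced U (take (l ∸ 1) (drop 1 C)))
          *ℤ det (induced U (drop (suc l) C)))
       +ℤ det (induced U (cyc m₁ m₂ v₁ ∷ map (t₁ n m₂) (allFin m₁)))
          *ℤ det T₂
          *ℤ det (induced U (drop 1 C))
theorem10 (suc (suc k)) (suc k₁) (suc k₂) _ σ T₁ T₂ r₁ r₂ zero (suc w′) s₁ s₂ _ _ _ _ _ _ _ refl _ _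
  = Unicyclic.TwoTreesOnACycle.det-unicyclic k k₁ k₂ σ T₁ T₂ r₁ r₂ w′ s₁ s₂
      (map-tabulate id (cyc (suc k₁) (suc k₂)))
      (map-tabulate id (t₁ (suc (suc k)) (suc k₂)))
      (map-tabulate id (t₂ (suc (suc k)) (suc k₁)))
theorem10 zero          _        _        _ _ _  _  _  _  _      _       _  _  ()                _ _ _ _ _ _ _ _ _
theorem10 (suc zero)    _        _        _ _ _  _  _  _  _      _       _  _  (s≤s ())          _ _ _ _ _ _ _ _ _
theorem10 (suc (suc k)) zero     _        _ _ _  _  () _  _      _       _  _  _ _ _ _ _ _ _ _ _ _
theorem10 (suc (suc k)) (suc k₁) zero     _ _ _  _  _  () _      _       _  _  _ _ _ _ _ _ _ _ _ _
theorem10 (suc (suc k)) (suc k₁) (suc k₂) _ _ _  _  _  _  (suc v) _      _  _  _ _ _ _ _ _ () _ _ _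
theorem10 (suc (suc k)) (suc k₁) (suc k₂) _ _ _  _  _  _  zero   zero    _  _  _ _ _ _ _ _ _ refl () _
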